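{- Let $G$ be a finite simple graph with $\nu(G)>0$. Then there exists an edge $e$ of $G$ such that $\nu(G-e)<\nu(G)$, where $G-e$ is the graph obtained from $G$ by removing the edge $e$.
   Context: For a finite simple graph $G$ with vertex set $\{v_1,\dots,v_n\}$, the closed neighborhood matrix $N(G)$ is the symmetric $n\times n$ matrix over $\mathbb{Z}_2$ whose $(i,j)$ entry is $1$ if $i=j$ or $v_iv_j$ is an edge, and $0$ otherwise. The nullity of $G$ is $\nu(G):=\dim_{\mathbb{Z}_2}\ker N(G)$. -}

module Defs where

open import Data.Nat using (ℕ; zero; suc)
open import Data.Fin using (Fin; zero; suc)
open import Data.Fin.Properties using (_≟_)
open import Data.Bool using (Bool; true; false; _∧_; _∨_; not; _xor_)
open import Data.Bool.Properties using (∧-comm; ∨-comm)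
open import Relation.Nullary.Decidable using (⌊_⌋)
open import Relation.Binary.PropositionalEquality using (_≡_; refl; cong₂)
open import Data.Product using (∃)

-- Z₂ is modelled by Bool: addition = _xor_, multiplication = _∧_, 0 = false, 1 = true.

record Graph (n : ℕ) : Set where
  field
    adj    : Fin n → Fin n → Bool
    sym    : ∀ x y → adj x y ≡ adj y x
    irrefl : ∀ x → adj x x ≡ false
open Graph public

IsEdge : ∀ {n} → Graph n → Fin n → Fin n → Set
IsEdge G i j = adj G i j ≡ true

hits : ∀ {n} → Fin n → Fin n → Fin n → Fin n → Bool
hits i j x y = (⌊ x ≟ i ⌋ ∧ ⌊ y ≟ j ⌋) ∨ (⌊ x ≟ j ⌋ ∧ ⌊ y ≟ i ⌋)

hits-sym : ∀ {n} (i j x y : Fin n) → hits i j x y ≡ hits i j y x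
hits-sym i j x y rewrite ∧-comm ⌊ x ≟ i ⌋ ⌊ y ≟ j ⌋ | ∧-comm ⌊ x ≟ j ⌋ ⌊ y ≟ i ⌋ =
  ∨-comm (⌊ y ≟ j ⌋ ∧ ⌊ x ≟ i ⌋) (⌊ y ≟ i ⌋ ∧ ⌊ x ≟ j ⌋)

removeEdge : ∀ {n} → Graph n → Fin n → Fin n → Graph n
removeEdge G i j = record
  { adj    = λ x y → adj G x y ∧ not (hits i j x y)
  ; sym    = λ x y → cong₂ (λ a b → a ∧ not b) (sym G x y) (hits-sym i j x y)
  ; irrefl = λ x → cong₂ (λ a b → a ∧ not b) (irrefl G x) (refl {x = hits i j x x})
  }

Σ₂ : ∀ {m} → (Fin m → Bool) → Bool
Σ₂ {zero}  f = false
Σ₂ {suc m} f = f zero xor Σ₂ (λ k → f (suc k))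

N : ∀ {n} → Graph n → Fin n → Fin n → Bool
N G i j = ⌊ i ≟ j ⌋ ∨ adj G i j

Vector : ℕ → Set
Vector n = Fin n → Bool

InKer : ∀ {n} → Graph n → Vector n → Set
InKer G v = ∀ i → Σ₂ (λ j → N G i j ∧ v j) ≡ false

lincomb : ∀ {n d} → (Fin d → Vector n) → (Fin d → Bool) → Vector n
lincomb B c k = Σ₂ (λ t → c t ∧ B t k)

record IsKerBasis {n : ℕ} (G : Graph n) (d : ℕ) (B : Fin d → Vector n) : Set where
  field
    inKer       : ∀ t → InKer G (B t)
    independent : ∀ (c : Fin d → Bool) → (∀ k → lincomb B c k ≡ false) → ∀ t → c t ≡ false
    spanning    : ∀ (v : Vector n) → InKer G v → ∃ λ (c : Fin d → Bool) → ∀ k → lincomb B c k ≡ v k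

-- ν(G) = d  :⇔  dim_{Z₂} ker N(G) = d  (ker N(G) has a basis with d elements).
Nullity : ∀ {n} → Graph n → ℕ → Set
Nullity G d = ∃ λ (B : Fin d → Vector _) → IsKerBasis G d B

{-# OPTIONS --safe #-}
-- Over Z₂ the diagonal of a symmetric matrix lies in its column space (eliminate a pivot on the
-- diagonal and recurse on the Schur complement), so N(G) y = 𝟙 for some y. A kernel vector v
-- with vᵢ = 1 lets us assume yᵢ = 0, and then row i of N(G) y = 𝟙 yields a neighbour j of i
-- with yⱼ = 1. For x in the kernel of N(G − ij) we have N(G) x = xⱼ eᵢ + xᵢ eⱼ; pairing with y
-- gives xᵢ = yᵀN(G)x = xᵀ𝟙 = xᵀN(G − ij)x = 0, and pairing with v gives xⱼ = 0. Hence
-- ker N(G − ij) = ker N(G) ∩ {xᵢ = 0} ∩ {xⱼ = 0}, a proper subspace since it misses v.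
module Submission where

open import Defs hiding (sym)
open import Data.Nat using (ℕ; zero; suc; _<_; _≤_; s≤s; z≤n)
open import Data.Nat.Properties using (≤-refl; n≤1+n)
open import Data.Fin using (Fin; zero; suc; punchIn; punchOut)
open import Data.Fin.Properties using (_≟_; any?; ¬∀⟶∃¬; punchIn-punchOut; punchInᵢ≢i)
open import Data.Bool using (Bool; true; false; _∧_; _∨_; not; _xor_)
open import Data.Bool.Properties
  using ( ∧-comm; ∧-assoc; ∧-identityʳ; ∧-zeroʳ; ∧-conicalˡ; ∧-conicalʳ
        ; xor-assoc; xor-comm; xor-identityʳ; xor-same; xor-inverseˡ; ¬-not
        ; ∧-idem; ∧-distribˡ-xor; ∧-distribʳ-xor; xor-∧-commutativeRing)
  renaming (_≟_ to _≟ᵇ_)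
open import Data.Vec.Functional using (insertAt; removeAt)
open import Data.Vec.Functional.Properties using (insertAt-lookup; insertAt-punchIn; insertAt-removeAt)
open import Data.Product using (∃; _×_; _,_; proj₁)
open import Data.Sum using (_⊎_; inj₁; inj₂)
open import Function using (_∘_; flip)
open import Algebra.Bundles using (CommutativeRing)
open import Relation.Nullary using (¬_; yes; no; contradiction)
open import Relation.Nullary.Decidable using (⌊_⌋; isYes≗does; dec-true; dec-false)
open import Relation.Binary.PropositionalEquality
  using (_≡_; _≢_; _≗_; refl; sym; trans; cong; cong₂; subst; module ≡-Reasoning)

open CommutativeRing xor-∧-commutativeRing using (semiring)
open import Algebra.Properties.Semiring.Sum semiring
  using (sum; sum-cong-≗; ∑-distrib-+; ∑-comm; *-distribˡ-sum; sum-remove; sum-replicate-zero)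
open ≡-Reasoning

private
  variable
    m n d : ℕ

xor-cancelʳ : ∀ x y → (x xor y) xor y ≡ x
xor-cancelʳ x y = trans (xor-assoc x y y) (trans (cong (x xor_) (xor-same y)) (xor-identityʳ x))

xor≡false⇒≡ : ∀ x y → x xor y ≡ false → x ≡ y
xor≡false⇒≡ false y h = sym h
xor≡false⇒≡ true true _ = refl

true≢false : true ≢ false
true≢false ()

∨≡true⇒⊎ : ∀ a b → a ∨ b ≡ true → a ≡ true ⊎ b ≡ true
∨≡true⇒⊎ true  b _ = inj₁ refl
∨≡true⇒⊎ false b h = inj₂ h

∨≡xor : ∀ a b → ¬ (a ≡ true × b ≡ true) → a ∨ b ≡ a xor b
∨≡xor false b     _ = refl
∨≡xor true  false _ = refl
∨≡xor true  true  h = contradiction (refl , refl) h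

∨-delete : ∀ a b h → (h ≡ true → a ≡ false × b ≡ true) → a ∨ b ≡ (a ∨ b ∧ not h) xor h
∨-delete a b false _ = sym (trans (xor-identityʳ (a ∨ b ∧ true)) (cong (a ∨_) (∧-identityʳ b)))
∨-delete a b true  h with h refl
... | refl , refl = refl

∧-reverse : ∀ a b c → a ∧ b ∧ c ≡ c ∧ b ∧ a
∧-reverse a b c = trans (∧-comm a (b ∧ c)) (trans (cong (_∧ a) (∧-comm b c)) (∧-assoc c b a))

∧-idem-outer : ∀ a b → a ∧ b ∧ a ≡ a ∧ b
∧-idem-outer false b = refl
∧-idem-outer true  b = ∧-identityʳ b

∃-true : (v : Vector m) → ¬ (∀ k → v k ≡ false) → ∃ λ k → v k ≡ true
∃-true {m} v v≢0 with ¬∀⟶∃¬ m _ (λ k → v k ≟ᵇ false) v≢0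
... | k , vₖ≢false = k , ¬-not vₖ≢false

Σ₂≡sum : (f : Fin m → Bool) → Σ₂ f ≡ sum f
Σ₂≡sum {zero}  f = refl
Σ₂≡sum {suc m} f = cong (f zero xor_) (Σ₂≡sum (f ∘ suc))

Σ₂-cong : {f g : Fin m → Bool} → f ≗ g → Σ₂ f ≡ Σ₂ g
Σ₂-cong {f = f} {g} f≗g rewrite Σ₂≡sum f | Σ₂≡sum g = sum-cong-≗ f≗g

Σ₂-zero : {f : Fin m → Bool} → (∀ k → f k ≡ false) → Σ₂ f ≡ false
Σ₂-zero {m} f≡0 = trans (Σ₂-cong f≡0) (trans (Σ₂≡sum {m} (λ _ → false)) (sum-replicate-zero m))

Σ₂-xor : (f g : Fin m → Bool) → Σ₂ (λ k → f k xor g k) ≡ Σ₂ f xor Σ₂ g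
Σ₂-xor f g rewrite Σ₂≡sum f | Σ₂≡sum g | Σ₂≡sum (λ k → f k xor g k) = ∑-distrib-+ f g

Σ₂-∧ˡ : (a : Bool) (f : Fin m → Bool) → Σ₂ (λ k → a ∧ f k) ≡ a ∧ Σ₂ f
Σ₂-∧ˡ a f rewrite Σ₂≡sum f | Σ₂≡sum (λ k → a ∧ f k) = sym (*-distribˡ-sum a f)

Σ₂-remove : (k : Fin (suc m)) (f : Fin (suc m) → Bool) → Σ₂ f ≡ f k xor Σ₂ (removeAt f k)
Σ₂-remove k f rewrite Σ₂≡sum f | Σ₂≡sum (removeAt f k) = sum-remove f

Σ₂-comm : (f : Fin m → Fin n → Bool) → Σ₂ (λ k → Σ₂ (f k)) ≡ Σ₂ (λ l → Σ₂ (λ k → f k l))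
Σ₂-comm f = begin
  Σ₂ (λ k → Σ₂ (f k))             ≡⟨ Σ₂²≡sum² f ⟩
  sum (λ k → sum (f k))           ≡⟨ ∑-comm f ⟩
  sum (λ l → sum (λ k → f k l))   ≡⟨ Σ₂²≡sum² (flip f) ⟨
  Σ₂ (λ l → Σ₂ (λ k → f k l))     ∎
  where
  Σ₂²≡sum² : ∀ {m n} (g : Fin m → Fin n → Bool) → Σ₂ (λ k → Σ₂ (g k)) ≡ sum (λ k → sum (g k))
  Σ₂²≡sum² {m} g = trans (Σ₂-cong (Σ₂≡sum ∘ g)) (Σ₂≡sum {m} (λ k → sum (g k)))

-- Over Z₂ the off-diagonal terms of a symmetric double sum cancel in pairs.
Σ₂²-symmetric : (f : Fin m → Fin m → Bool) → (∀ k l → f k l ≡ f l k) →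
                Σ₂ (λ k → Σ₂ (f k)) ≡ Σ₂ (λ k → f k k)
Σ₂²-symmetric {zero}  f f-sym = refl
Σ₂²-symmetric {suc m} f f-sym = begin
  (f₀₀ xor R) xor Σ₂ (λ k → f (suc k) zero xor Σ₂ (f (suc k) ∘ suc))
    ≡⟨ cong ((f₀₀ xor R) xor_) (Σ₂-xor (λ k → f (suc k) zero) (λ k → Σ₂ (f (suc k) ∘ suc))) ⟩
  (f₀₀ xor R) xor (Σ₂ (λ k → f (suc k) zero) xor Σ₂ (λ k → Σ₂ (f (suc k) ∘ suc)))
    ≡⟨ cong₂ (λ a b → (f₀₀ xor R) xor (a xor b))
             (Σ₂-cong (λ k → f-sym (suc k) zero))
             (Σ₂²-symmetric (λ k l → f (suc k) (suc l)) (λ k l → f-sym (suc k) (suc l))) ⟩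
  (f₀₀ xor R) xor (R xor D)
    ≡⟨ xor-assoc (f₀₀ xor R) R D ⟨
  ((f₀₀ xor R) xor R) xor D
    ≡⟨ cong (_xor D) (xor-cancelʳ f₀₀ R) ⟩
  f₀₀ xor D ∎
  where
  f₀₀ = f zero zero
  R = Σ₂ (f zero ∘ suc)
  D = Σ₂ (λ k → f (suc k) (suc k))

Σ₂≡true⇒∃ : (f : Fin m → Bool) → Σ₂ f ≡ true → ∃ λ k → f k ≡ true
Σ₂≡true⇒∃ f Σf≡true = ∃-true f λ f≡0 → true≢false (trans (sym Σf≡true) (Σ₂-zero f≡0))

infixl 6 _⊕_
infixr 7 _⊙_
infix  8 _·_

_⊕_ : Vector n → Vector n → Vector n
(u ⊕ w) k = u k xor w k

_⊙_ : Bool → Vector n → Vector n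
(a ⊙ w) k = a ∧ w k

_·_ : Vector n → Vector n → Bool
u · w = Σ₂ (λ k → u k ∧ w k)

δ : Fin n → Vector n
δ i k = ⌊ k ≟ i ⌋

δ-refl : (i : Fin n) → δ i i ≡ true
δ-refl i = trans (isYes≗does (i ≟ i)) (dec-true (i ≟ i) refl)

δ-≢ : {i k : Fin n} → k ≢ i → δ i k ≡ false
δ-≢ {i = i} {k} k≢i = trans (isYes≗does (k ≟ i)) (dec-false (k ≟ i) k≢i)

δ≡true⇒≡ : {i k : Fin n} → δ i k ≡ true → k ≡ i
δ≡true⇒≡ {i = i} {k} _ with k ≟ i
... | yes k≡i = k≡i

δ-sym : (i k : Fin n) → δ i k ≡ δ k i
δ-sym i k with k ≟ i
... | yes refl = sym (δ-refl k)
... | no k≢i = sym (δ-≢ (k≢i ∘ sym))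

·-comm : (u w : Vector n) → u · w ≡ w · u
·-comm u w = Σ₂-cong (λ k → ∧-comm (u k) (w k))

·-congʳ : (u : Vector n) {w w′ : Vector n} → w ≗ w′ → u · w ≡ u · w′
·-congʳ u w≗w′ = Σ₂-cong (λ k → cong (u _ ∧_) (w≗w′ k))

·-zeroʳ : (u : Vector n) {w : Vector n} → (∀ k → w k ≡ false) → u · w ≡ false
·-zeroʳ u w≡0 = Σ₂-zero (λ k → trans (cong (u k ∧_) (w≡0 k)) (∧-zeroʳ (u k)))

·-distribˡ-⊕ : (u v w : Vector n) → (u ⊕ v) · w ≡ u · w xor v · w
·-distribˡ-⊕ u v w =
  trans (Σ₂-cong (λ k → ∧-distribʳ-xor (w k) (u k) (v k)))
        (Σ₂-xor (λ k → u k ∧ w k) (λ k → v k ∧ w k))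

·-distribʳ-⊕ : (u v w : Vector n) → u · (v ⊕ w) ≡ u · v xor u · w
·-distribʳ-⊕ u v w =
  trans (Σ₂-cong (λ k → ∧-distribˡ-xor (u k) (v k) (w k)))
        (Σ₂-xor (λ k → u k ∧ v k) (λ k → u k ∧ w k))

·-⊙ˡ : (a : Bool) (u w : Vector n) → (a ⊙ u) · w ≡ a ∧ u · w
·-⊙ˡ a u w = trans (Σ₂-cong (λ k → ∧-assoc a (u k) (w k))) (Σ₂-∧ˡ a (λ k → u k ∧ w k))

·-⊙ʳ : (a : Bool) (u w : Vector n) → u · (a ⊙ w) ≡ a ∧ u · w
·-⊙ʳ a u w = trans (Σ₂-cong (λ k → ∧-swap (u k))) (Σ₂-∧ˡ a (λ k → u k ∧ w k))
  where
  ∧-swap : ∀ x {y} → x ∧ a ∧ y ≡ a ∧ x ∧ y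
  ∧-swap x {y} = trans (sym (∧-assoc x a y)) (trans (cong (_∧ y) (∧-comm x a)) (∧-assoc a x y))

δ-· : (i : Fin n) (w : Vector n) → δ i · w ≡ w i
δ-· {suc n} i w = begin
  δ i · w
    ≡⟨ Σ₂-remove i (λ k → δ i k ∧ w k) ⟩
  (δ i i ∧ w i) xor Σ₂ (removeAt (λ k → δ i k ∧ w k) i)
    ≡⟨ cong₂ _xor_ (cong (_∧ w i) (δ-refl i)) off-diagonal ⟩
  w i xor false
    ≡⟨ xor-identityʳ (w i) ⟩
  w i ∎
  where
  off-diagonal : Σ₂ (removeAt (λ k → δ i k ∧ w k) i) ≡ false
  off-diagonal = Σ₂-zero (λ s → cong (_∧ w (punchIn i s)) (δ-≢ (punchInᵢ≢i i s)))

·-δ : (w : Vector n) (i : Fin n) → w · δ i ≡ w i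
·-δ w i = trans (·-comm w (δ i)) (δ-· i w)

insertAt-· : (z : Vector n) (k : Fin (suc n)) (a : Bool) (w : Vector (suc n)) →
             insertAt z k a · w ≡ (a ∧ w k) xor (z · removeAt w k)
insertAt-· z k a w = trans (Σ₂-remove k (λ t → insertAt z k a t ∧ w t))
  (cong₂ _xor_ (cong (_∧ w k) (insertAt-lookup z k a))
               (Σ₂-cong (λ s → cong (_∧ w (punchIn k s)) (insertAt-punchIn z k a s))))

·-insertAt : (w : Vector (suc n)) (z : Vector n) (k : Fin (suc n)) (a : Bool) →
             w · insertAt z k a ≡ (w k ∧ a) xor (removeAt w k · z)
·-insertAt w z k a = trans (Σ₂-remove k (λ t → w t ∧ insertAt z k a t))
  (cong₂ _xor_ (cong (w k ∧_) (insertAt-lookup z k a))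
               (Σ₂-cong (λ s → cong (w (punchIn k s) ∧_) (insertAt-punchIn z k a s))))

Matrix : ℕ → Set
Matrix n = Fin n → Fin n → Bool

infixr 7 _*ᵥ_

_*ᵥ_ : Matrix n → Vector n → Vector n
(M *ᵥ x) k = M k · x

diag : Matrix n → Vector n
diag M k = M k k

IsSymmetric : Matrix n → Set
IsSymmetric M = ∀ k l → M k l ≡ M l k

·-*ᵥ-expand : (u : Vector n) (M : Matrix n) (w : Vector n) →
              u · (M *ᵥ w) ≡ Σ₂ (λ k → Σ₂ (λ l → u k ∧ M k l ∧ w l))
·-*ᵥ-expand u M w = Σ₂-cong (λ k → sym (Σ₂-∧ˡ (u k) (λ l → M k l ∧ w l)))

module _ {M : Matrix n} (M-sym : IsSymmetric M) where

  entry-swap : (u w : Vector n) (k l : Fin n) → u k ∧ M k l ∧ w l ≡ w l ∧ M l k ∧ u k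
  entry-swap u w k l = trans (cong (λ b → u k ∧ b ∧ w l) (M-sym k l)) (∧-reverse (u k) (M l k) (w l))

  *ᵥ-selfAdjoint : (u w : Vector n) → u · (M *ᵥ w) ≡ w · (M *ᵥ u)
  *ᵥ-selfAdjoint u w = begin
    u · (M *ᵥ w)
      ≡⟨ ·-*ᵥ-expand u M w ⟩
    Σ₂ (λ k → Σ₂ (λ l → u k ∧ M k l ∧ w l))
      ≡⟨ Σ₂-comm (λ k l → u k ∧ M k l ∧ w l) ⟩
    Σ₂ (λ l → Σ₂ (λ k → u k ∧ M k l ∧ w l))
      ≡⟨ Σ₂-cong (λ l → Σ₂-cong (λ k → entry-swap u w k l)) ⟩
    Σ₂ (λ l → Σ₂ (λ k → w l ∧ M l k ∧ u k))
      ≡⟨ ·-*ᵥ-expand w M u ⟨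
    w · (M *ᵥ u) ∎

  ·-*ᵥ-diag : (x : Vector n) → x · (M *ᵥ x) ≡ x · diag M
  ·-*ᵥ-diag x = begin
    x · (M *ᵥ x)
      ≡⟨ ·-*ᵥ-expand x M x ⟩
    Σ₂ (λ k → Σ₂ (λ l → x k ∧ M k l ∧ x l))
      ≡⟨ Σ₂²-symmetric (λ k l → x k ∧ M k l ∧ x l) (entry-swap x x) ⟩
    Σ₂ (λ k → x k ∧ M k k ∧ x k)
      ≡⟨ Σ₂-cong (λ k → ∧-idem-outer (x k) (M k k)) ⟩
    x · diag M ∎

  ker⊥diag : {x : Vector n} → (∀ k → (M *ᵥ x) k ≡ false) → x · diag M ≡ false
  ker⊥diag {x} Mx≡0 = trans (sym (·-*ᵥ-diag x)) (·-zeroʳ x Mx≡0)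

punchIn-cases : {P : Fin (suc n) → Set} (k : Fin (suc n)) → P k → (∀ s → P (punchIn k s)) → ∀ s → P s
punchIn-cases {P = P} k Pk Pπ s with k ≟ s
... | yes refl = Pk
... | no k≢s = subst P (punchIn-punchOut k≢s) (Pπ (punchOut k≢s))

module SchurComplement {M : Matrix (suc n)} (M-sym : IsSymmetric M) (k : Fin (suc n)) (Mₖₖ : M k k ≡ true) where

  S : Matrix n
  S s = removeAt (M (punchIn k s)) k ⊕ M (punchIn k s) k ⊙ removeAt (M k) k

  S-sym : IsSymmetric S
  S-sym s t = cong₂ _xor_ (M-sym _ _)
    (trans (cong₂ _∧_ (M-sym (punchIn k s) k) (M-sym k (punchIn k t)))
           (∧-comm (M k (punchIn k s)) (M (punchIn k t) k)))

  -- xₖ = not β makes row k sum to 1 = Mₖₖ; each other row p reduces to row s of S z = diag S,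
  -- because over Z₂ the correction term of diag S is M p k ∧ M k p = M p k.
  extend : (∃ λ z → S *ᵥ z ≗ diag S) → ∃ λ x → M *ᵥ x ≗ diag M
  extend (z , Sz≗diag) = x , punchIn-cases k row-k row-punchIn
    where
    β : Bool
    β = removeAt (M k) k · z

    x : Vector (suc n)
    x = insertAt z k (not β)

    row-k : (M *ᵥ x) k ≡ M k k
    row-k = begin
      M k · x                         ≡⟨ ·-insertAt (M k) z k (not β) ⟩
      (M k k ∧ not β) xor β           ≡⟨ cong (λ b → (b ∧ not β) xor β) Mₖₖ ⟩
      not β xor β                     ≡⟨ xor-inverseˡ β ⟩
      true                            ≡⟨ Mₖₖ ⟨
      M k k                           ∎

    row-punchIn : ∀ s → (M *ᵥ x) (punchIn k s) ≡ M (punchIn k s) (punchIn k s)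
    row-punchIn s = begin
      M p · x                         ≡⟨ ·-insertAt (M p) z k (not β) ⟩
      (b ∧ not β) xor A               ≡⟨ cong (_xor A) (∧-distribˡ-xor b true β) ⟩
      (b ∧ true xor b ∧ β) xor A      ≡⟨ cong (λ c → (c xor b ∧ β) xor A) (∧-identityʳ b) ⟩
      (b xor b ∧ β) xor A             ≡⟨ xor-assoc b (b ∧ β) A ⟩
      b xor (b ∧ β xor A)             ≡⟨ cong (b xor_) (xor-comm (b ∧ β) A) ⟩
      b xor (A xor b ∧ β)             ≡⟨ cong (b xor_) schur-row ⟩
      b xor (M p p xor b)             ≡⟨ xor-comm b (M p p xor b) ⟩
      (M p p xor b) xor b             ≡⟨ xor-cancelʳ (M p p) b ⟩
      M p p                           ∎
      where
      p = punchIn k s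
      b = M p k
      A = removeAt (M p) k · z
      schur-row : A xor b ∧ β ≡ M p p xor b
      schur-row = begin
        A xor b ∧ β                   ≡⟨ cong (A xor_) (·-⊙ˡ b (removeAt (M k) k) z) ⟨
        A xor (b ⊙ removeAt (M k) k) · z
                                      ≡⟨ ·-distribˡ-⊕ (removeAt (M p) k) (b ⊙ removeAt (M k) k) z ⟨
        S s · z                       ≡⟨ Sz≗diag s ⟩
        M p p xor b ∧ M k p           ≡⟨ cong (λ c → M p p xor b ∧ c) (M-sym k p) ⟩
        M p p xor b ∧ b               ≡⟨ cong (M p p xor_) (∧-idem b) ⟩
        M p p xor b                   ∎

diag∈image : {M : Matrix n} → IsSymmetric M → ∃ λ x → M *ᵥ x ≗ diag M
diag∈image {zero} M-sym = (λ ()) , λ ()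
diag∈image {suc n} {M} M-sym with any? (λ k → M k k ≟ᵇ true)
... | yes (k , Mₖₖ) = extend (diag∈image S-sym)
  where open SchurComplement M-sym k Mₖₖ
... | no no-pivot = (λ _ → false) , λ s →
  trans (·-zeroʳ (M s) (λ _ → refl)) (sym (¬-not (no-pivot ∘ (s ,_))))

diag∈image-avoiding : {M : Matrix n} → IsSymmetric M → {v : Vector n} → (∀ k → (M *ᵥ v) k ≡ false) →
                      {i : Fin n} → v i ≡ true → ∃ λ y → M *ᵥ y ≗ diag M × y i ≡ false
diag∈image-avoiding {M = M} M-sym {v} Mv≡0 {i} vᵢ with diag∈image M-sym
... | y , My≗diag with y i in yᵢ
...   | false = y , My≗diag , yᵢ
...   | true  = y ⊕ v , My⊕v≗diag , cong₂ _xor_ yᵢ vᵢ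
  where
  My⊕v≗diag : M *ᵥ (y ⊕ v) ≗ diag M
  My⊕v≗diag k = trans (·-distribʳ-⊕ (M k) y v)
    (trans (cong₂ _xor_ (My≗diag k) (Mv≡0 k)) (xor-identityʳ (M k k)))

IsLinearlyClosed : (Vector n → Set) → Set
IsLinearlyClosed P = ∀ x y b → P x → P y → P (x ⊕ b ⊙ y)

ZeroAt : Fin n → (Vector n → Set) → Vector n → Set
ZeroAt i P x = P x × x i ≡ false

ZeroAt-closed : {P : Vector n → Set} (i : Fin n) → IsLinearlyClosed P → IsLinearlyClosed (ZeroAt i P)
ZeroAt-closed i P-closed x y b (Px , xᵢ) (Py , yᵢ) =
  P-closed x y b Px Py , trans (cong₂ (λ c e → c xor b ∧ e) xᵢ yᵢ) (∧-zeroʳ b)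

record IsBasis (P : Vector n → Set) (d : ℕ) (B : Fin d → Vector n) : Set where
  field
    member      : ∀ t → P (B t)
    independent : ∀ (c : Fin d → Bool) → (∀ k → lincomb B c k ≡ false) → ∀ t → c t ≡ false
    spanning    : ∀ (v : Vector n) → P v → ∃ λ (c : Fin d → Bool) → ∀ k → lincomb B c k ≡ v k

IsBasis-cong : {P Q : Vector n → Set} {B : Fin d → Vector n} →
               (∀ x → P x → Q x) → (∀ x → Q x → P x) → IsBasis P d B → IsBasis Q d B
IsBasis-cong P⇒Q Q⇒P B-basis = record
  { member      = λ t → P⇒Q _ (member t)
  ; independent = independent
  ; spanning    = λ v Qv → spanning v (Q⇒P v Qv)
  }
  where open IsBasis B-basis

column : (Fin d → Vector n) → Fin n → Vector d
column B k t = B t k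

basis-nonzero : {P : Vector n → Set} {B : Fin d → Vector n} → IsBasis P d B → ∀ t → ∃ λ k → B t k ≡ true
basis-nonzero {B = B} B-basis t = ∃-true (B t) Bₜ≢0
  where
  Bₜ≢0 : ¬ (∀ k → B t k ≡ false)
  Bₜ≢0 Bₜ≡0 = true≢false (trans (sym (δ-refl t)) (IsBasis.independent B-basis (δ t) δₜ-comb≡0 t))
    where
    δₜ-comb≡0 : ∀ k → lincomb B (δ t) k ≡ false
    δₜ-comb≡0 k = trans (δ-· t (column B k)) (Bₜ≡0 k)

module _ {P : Vector n → Set} (P-closed : IsLinearlyClosed P)
         {B : Fin (suc d) → Vector n} (B-basis : IsBasis P (suc d) B)
         {t₀ : Fin (suc d)} {i : Fin n} (pivot : B t₀ i ≡ true) where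

  open IsBasis B-basis

  reduced : Fin d → Vector n
  reduced s = B (punchIn t₀ s) ⊕ B (punchIn t₀ s) i ⊙ B t₀

  lincomb-reduced : ∀ c k → lincomb reduced c k ≡ lincomb B (insertAt c t₀ (lincomb (removeAt B t₀) c i)) k
  lincomb-reduced c k = begin
    c · column reduced k
      ≡⟨ ·-congʳ c (λ s → cong (B (punchIn t₀ s) k xor_) (∧-comm (B (punchIn t₀ s) i) (B t₀ k))) ⟩
    c · (column B′ k ⊕ B t₀ k ⊙ column B′ i)
      ≡⟨ ·-distribʳ-⊕ c (column B′ k) (B t₀ k ⊙ column B′ i) ⟩
    c · column B′ k xor c · (B t₀ k ⊙ column B′ i)
      ≡⟨ cong (c · column B′ k xor_) (·-⊙ʳ (B t₀ k) c (column B′ i)) ⟩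
    c · column B′ k xor B t₀ k ∧ γ
      ≡⟨ xor-comm (c · column B′ k) (B t₀ k ∧ γ) ⟩
    B t₀ k ∧ γ xor c · column B′ k
      ≡⟨ cong (_xor c · column B′ k) (∧-comm (B t₀ k) γ) ⟩
    γ ∧ B t₀ k xor c · column B′ k
      ≡⟨ insertAt-· c t₀ γ (column B k) ⟨
    insertAt c t₀ γ · column B k
      ∎
    where
    B′ = removeAt B t₀
    γ = lincomb B′ c i

  basis-ZeroAt-pivot : IsBasis (ZeroAt i P) d reduced
  basis-ZeroAt-pivot = record
    { member      = λ s → P-closed _ _ _ (member (punchIn t₀ s)) (member t₀) , reducedᵢ≡0 s
    ; independent = independent′
    ; spanning    = spanning′
    }
    where
    reducedᵢ≡0 : ∀ s → reduced s i ≡ false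
    reducedᵢ≡0 s = trans (cong (λ b → a xor a ∧ b) pivot)
                         (trans (cong (a xor_) (∧-identityʳ a)) (xor-same a))
      where a = B (punchIn t₀ s) i

    independent′ : ∀ c → (∀ k → lincomb reduced c k ≡ false) → ∀ s → c s ≡ false
    independent′ c reduced-c≡0 s =
      trans (sym (insertAt-punchIn c t₀ γ s))
            (independent (insertAt c t₀ γ) (λ k → trans (sym (lincomb-reduced c k)) (reduced-c≡0 k))
                         (punchIn t₀ s))
      where γ = lincomb (removeAt B t₀) c i

    spanning′ : ∀ v → ZeroAt i P v → ∃ λ c′ → ∀ k → lincomb reduced c′ k ≡ v k
    spanning′ v (Pv , vᵢ) with spanning v Pv
    ... | c , Bc≗v = c′ , λ k → begin
      lincomb reduced c′ k
        ≡⟨ lincomb-reduced c′ k ⟩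
      lincomb B (insertAt c′ t₀ γ) k
        ≡⟨ cong (λ a → lincomb B (insertAt c′ t₀ a) k) γ≡cₜ₀ ⟩
      lincomb B (insertAt c′ t₀ (c t₀)) k
        ≡⟨ Σ₂-cong (λ t → cong (_∧ B t k) (insertAt-removeAt c t₀ t)) ⟩
      lincomb B c k
        ≡⟨ Bc≗v k ⟩
      v k ∎
      where
      c′ = removeAt c t₀
      γ = lincomb (removeAt B t₀) c′ i
      cₜ₀xorγ≡0 : c t₀ xor γ ≡ false
      cₜ₀xorγ≡0 = begin
        c t₀ xor γ                   ≡⟨ cong (_xor γ) (∧-identityʳ (c t₀)) ⟨
        c t₀ ∧ true xor γ            ≡⟨ cong (λ b → c t₀ ∧ b xor γ) pivot ⟨
        c t₀ ∧ B t₀ i xor γ          ≡⟨ Σ₂-remove t₀ (λ t → c t ∧ B t i) ⟨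
        lincomb B c i                ≡⟨ Bc≗v i ⟩
        v i                          ≡⟨ vᵢ ⟩
        false                        ∎
      γ≡cₜ₀ : γ ≡ c t₀
      γ≡cₜ₀ = sym (xor≡false⇒≡ (c t₀) γ cₜ₀xorγ≡0)

basis-ZeroAt : {P : Vector n → Set} {B : Fin d → Vector n} → IsLinearlyClosed P → IsBasis P d B →
               (i : Fin n) → ∃ λ d′ → d′ ≤ d × ∃ (IsBasis (ZeroAt i P) d′)
basis-ZeroAt {B = B} P-closed B-basis i with any? (λ t → B t i ≟ᵇ true)
basis-ZeroAt {d = suc d} P-closed B-basis i | yes (t₀ , pivot) =
  d , n≤1+n d , _ , basis-ZeroAt-pivot P-closed B-basis pivot
... | no no-pivot = _ , ≤-refl , B , record
  { member      = λ t → member t , ¬-not (no-pivot ∘ (t ,_))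
  ; independent = independent
  ; spanning    = λ v → spanning v ∘ proj₁
  }
  where open IsBasis B-basis

N-sym : (G : Graph n) → IsSymmetric (N G)
N-sym G k l = cong₂ _∨_ (δ-sym l k) (Graph.sym G k l)

N-diag : (G : Graph n) (k : Fin n) → N G k k ≡ true
N-diag G k = cong (_∨ adj G k k) (δ-refl k)

N-offDiag : (G : Graph n) {k l : Fin n} → k ≢ l → N G k l ≡ adj G k l
N-offDiag G {k} {l} k≢l = cong (_∨ adj G k l) (δ-≢ k≢l)

InKer-closed : (G : Graph n) → IsLinearlyClosed (InKer G)
InKer-closed G x y b Nx≡0 Ny≡0 k = begin
  N G k · (x ⊕ b ⊙ y)             ≡⟨ ·-distribʳ-⊕ (N G k) x (b ⊙ y) ⟩
  N G k · x xor N G k · (b ⊙ y)   ≡⟨ cong (N G k · x xor_) (·-⊙ʳ b (N G k) y) ⟩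
  N G k · x xor b ∧ N G k · y     ≡⟨ cong₂ (λ c e → c xor b ∧ e) (Nx≡0 k) (Ny≡0 k) ⟩
  b ∧ false                       ≡⟨ ∧-zeroʳ b ⟩
  false                           ∎

∃-neighbour : (G : Graph n) {y : Vector n} {i : Fin n} → (N G *ᵥ y) i ≡ true → y i ≡ false →
              ∃ λ j → IsEdge G i j × y j ≡ true
∃-neighbour G {y} {i} Nyᵢ≡true yᵢ with Σ₂≡true⇒∃ (λ l → N G i l ∧ y l) Nyᵢ≡true
... | j , Nᵢⱼyⱼ = j , trans (sym (N-offDiag G i≢j)) (∧-conicalˡ _ _ Nᵢⱼyⱼ) , yⱼ
  where
  yⱼ = ∧-conicalʳ _ _ Nᵢⱼyⱼ
  i≢j : i ≢ j
  i≢j refl = true≢false (trans (sym yⱼ) yᵢ)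

module EdgeDeletion (G : Graph n) {i j : Fin n} (ij : IsEdge G i j) where

  G-e : Graph n
  G-e = removeEdge G i j

  i≢j : i ≢ j
  i≢j refl = true≢false (trans (sym ij) (irrefl G i))

  hits⇒edge : ∀ {k l} → hits i j k l ≡ true → δ l k ≡ false × adj G k l ≡ true
  hits⇒edge {k} {l} h with ∨≡true⇒⊎ (δ i k ∧ δ j l) (δ j k ∧ δ i l) h
  ... | inj₁ h₁ with δ≡true⇒≡ (∧-conicalˡ (δ i k) _ h₁) | δ≡true⇒≡ (∧-conicalʳ _ (δ j l) h₁)
  ...   | refl | refl = δ-≢ i≢j , ij
  hits⇒edge {k} {l} h | inj₂ h₂
    with δ≡true⇒≡ (∧-conicalˡ (δ j k) _ h₂) | δ≡true⇒≡ (∧-conicalʳ _ (δ i l) h₂)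
  ...   | refl | refl = δ-≢ (i≢j ∘ sym) , trans (Graph.sym G j i) ij

  N-removeEdge : ∀ k l → N G k l ≡ N G-e k l xor hits i j k l
  N-removeEdge k l = ∨-delete (δ l k) (adj G k l) (hits i j k l) hits⇒edge

  hits-xor : ∀ k l → hits i j k l ≡ δ i k ∧ δ j l xor δ j k ∧ δ i l
  hits-xor k l = ∨≡xor (δ i k ∧ δ j l) (δ j k ∧ δ i l) λ (p , q) →
    i≢j (trans (sym (δ≡true⇒≡ (∧-conicalˡ (δ i k) _ p))) (δ≡true⇒≡ (∧-conicalˡ (δ j k) _ q)))

  hits-· : ∀ k (x : Vector n) → hits i j k · x ≡ x j ∧ δ i k xor x i ∧ δ j k
  hits-· k x = begin
    hits i j k · x
      ≡⟨ Σ₂-cong (λ l → cong (_∧ x l) (hits-xor k l)) ⟩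
    (δ i k ⊙ δ j ⊕ δ j k ⊙ δ i) · x
      ≡⟨ ·-distribˡ-⊕ (δ i k ⊙ δ j) (δ j k ⊙ δ i) x ⟩
    (δ i k ⊙ δ j) · x xor (δ j k ⊙ δ i) · x
      ≡⟨ cong₂ _xor_ (·-⊙ˡ (δ i k) (δ j) x) (·-⊙ˡ (δ j k) (δ i) x) ⟩
    δ i k ∧ δ j · x xor δ j k ∧ δ i · x
      ≡⟨ cong₂ (λ a b → δ i k ∧ a xor δ j k ∧ b) (δ-· j x) (δ-· i x) ⟩
    δ i k ∧ x j xor δ j k ∧ x i
      ≡⟨ cong₂ _xor_ (∧-comm (δ i k) (x j)) (∧-comm (δ j k) (x i)) ⟩
    x j ∧ δ i k xor x i ∧ δ j k ∎

  N*ᵥ-removeEdge : (x : Vector n) → N G *ᵥ x ≗ N G-e *ᵥ x ⊕ (x j ⊙ δ i ⊕ x i ⊙ δ j)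
  N*ᵥ-removeEdge x k = begin
    N G k · x
      ≡⟨ Σ₂-cong (λ l → cong (_∧ x l) (N-removeEdge k l)) ⟩
    (N G-e k ⊕ hits i j k) · x
      ≡⟨ ·-distribˡ-⊕ (N G-e k) (hits i j k) x ⟩
    N G-e k · x xor hits i j k · x
      ≡⟨ cong (N G-e k · x xor_) (hits-· k x) ⟩
    N G-e k · x xor (x j ∧ δ i k xor x i ∧ δ j k) ∎

  N*ᵥ-removeEdge-ZeroAt : {x : Vector n} → x i ≡ false → x j ≡ false → N G *ᵥ x ≗ N G-e *ᵥ x
  N*ᵥ-removeEdge-ZeroAt {x} xᵢ xⱼ k = begin
    (N G *ᵥ x) k
      ≡⟨ N*ᵥ-removeEdge x k ⟩
    (N G-e *ᵥ x) k xor (x j ∧ δ i k xor x i ∧ δ j k)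
      ≡⟨ cong₂ (λ a b → (N G-e *ᵥ x) k xor (a ∧ δ i k xor b ∧ δ j k)) xⱼ xᵢ ⟩
    (N G-e *ᵥ x) k xor false
      ≡⟨ xor-identityʳ _ ⟩
    (N G-e *ᵥ x) k ∎

  ·-N*ᵥ-ker : {x : Vector n} → InKer G-e x → (u : Vector n) → u · (N G *ᵥ x) ≡ x j ∧ u i xor x i ∧ u j
  ·-N*ᵥ-ker {x} N-e-x≡0 u = begin
    u · (N G *ᵥ x)
      ≡⟨ ·-congʳ u (N*ᵥ-removeEdge x) ⟩
    u · (N G-e *ᵥ x ⊕ (x j ⊙ δ i ⊕ x i ⊙ δ j))
      ≡⟨ ·-distribʳ-⊕ u (N G-e *ᵥ x) (x j ⊙ δ i ⊕ x i ⊙ δ j) ⟩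
    u · (N G-e *ᵥ x) xor u · (x j ⊙ δ i ⊕ x i ⊙ δ j)
      ≡⟨ cong (_xor _) (·-zeroʳ u N-e-x≡0) ⟩
    u · (x j ⊙ δ i ⊕ x i ⊙ δ j)
      ≡⟨ ·-distribʳ-⊕ u (x j ⊙ δ i) (x i ⊙ δ j) ⟩
    u · (x j ⊙ δ i) xor u · (x i ⊙ δ j)
      ≡⟨ cong₂ _xor_ (·-⊙ʳ (x j) u (δ i)) (·-⊙ʳ (x i) u (δ j)) ⟩
    x j ∧ u · δ i xor x i ∧ u · δ j
      ≡⟨ cong₂ (λ a b → x j ∧ a xor x i ∧ b) (·-δ u i) (·-δ u j) ⟩
    x j ∧ u i xor x i ∧ u j ∎

  ker-removeEdge⇐ : ∀ x → ZeroAt j (ZeroAt i (InKer G)) x → InKer G-e x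
  ker-removeEdge⇐ x ((Nx≡0 , xᵢ) , xⱼ) k = trans (sym (N*ᵥ-removeEdge-ZeroAt xᵢ xⱼ k)) (Nx≡0 k)

  ker-removeEdge⇒ : {y v : Vector n} → N G *ᵥ y ≗ diag (N G) → y i ≡ false → y j ≡ true →
                    InKer G v → v i ≡ true → ∀ x → InKer G-e x → ZeroAt j (ZeroAt i (InKer G)) x
  ker-removeEdge⇒ {y} {v} Ny≗diag yᵢ yⱼ Nv≡0 vᵢ x N-e-x≡0 = (Nx≡0 , xᵢ) , xⱼ
    where
    Ny≗diag-e : N G *ᵥ y ≗ diag (N G-e)
    Ny≗diag-e k = trans (Ny≗diag k) (trans (N-diag G k) (sym (N-diag G-e k)))

    xᵢ : x i ≡ false
    xᵢ = begin
      x i                       ≡⟨ trans (cong₂ (λ a b → x j ∧ a xor x i ∧ b) yᵢ yⱼ)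
                                         (cong₂ _xor_ (∧-zeroʳ (x j)) (∧-identityʳ (x i))) ⟨
      x j ∧ y i xor x i ∧ y j   ≡⟨ ·-N*ᵥ-ker N-e-x≡0 y ⟨
      y · (N G *ᵥ x)            ≡⟨ *ᵥ-selfAdjoint (N-sym G) y x ⟩
      x · (N G *ᵥ y)            ≡⟨ ·-congʳ x Ny≗diag-e ⟩
      x · diag (N G-e)          ≡⟨ ker⊥diag (N-sym G-e) N-e-x≡0 ⟩
      false                     ∎

    xⱼ : x j ≡ false
    xⱼ = begin
      x j                       ≡⟨ trans (cong₂ (λ a b → x j ∧ a xor b ∧ v j) vᵢ xᵢ)
                                         (trans (cong (_xor false) (∧-identityʳ (x j))) (xor-identityʳ (x j))) ⟨
      x j ∧ v i xor x i ∧ v j   ≡⟨ ·-N*ᵥ-ker N-e-x≡0 v ⟨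
      v · (N G *ᵥ x)            ≡⟨ *ᵥ-selfAdjoint (N-sym G) v x ⟩
      x · (N G *ᵥ v)            ≡⟨ ·-zeroʳ x Nv≡0 ⟩
      false                     ∎

    Nx≡0 : InKer G x
    Nx≡0 k = trans (N*ᵥ-removeEdge-ZeroAt xᵢ xⱼ k) (N-e-x≡0 k)

fromKerBasis : {G : Graph n} {B : Fin d → Vector n} → IsKerBasis G d B → IsBasis (InKer G) d B
fromKerBasis B-basis = record { member = inKer ; independent = independent ; spanning = spanning }
  where open IsKerBasis B-basis

toKerBasis : {G : Graph n} {B : Fin d → Vector n} → IsBasis (InKer G) d B → IsKerBasis G d B
toKerBasis B-basis = record { inKer = member ; independent = independent ; spanning = spanning }
  where open IsBasis B-basis

mainTheorem1 : ∀ {n : ℕ} (G : Graph n) (d : ℕ) → Nullity G d → 0 < d →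
    ∃ λ (i : Fin n) → ∃ λ (j : Fin n) → IsEdge G i j ×
      (∃ λ (d′ : ℕ) → Nullity (removeEdge G i j) d′ × d′ < d)
mainTheorem1 G (suc d) (B , B-kerBasis) (s≤s z≤n) =
  let B-basis                     = fromKerBasis B-kerBasis
      Nv≡0                        = IsBasis.member B-basis zero
      (i , vᵢ)                    = basis-nonzero B-basis zero
      (y , Ny≗diag , yᵢ)          = diag∈image-avoiding (N-sym G) Nv≡0 vᵢ
      (j , ij , yⱼ)               = ∃-neighbour G (trans (Ny≗diag i) (N-diag G i)) yᵢ
      B′-basis                    = basis-ZeroAt-pivot (InKer-closed G) B-basis vᵢ
      (d′ , d′≤d , B″ , B″-basis) = basis-ZeroAt (ZeroAt-closed i (InKer-closed G)) B′-basis j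
      open EdgeDeletion G ij
      B″-kerBasis = IsBasis-cong ker-removeEdge⇐ (ker-removeEdge⇒ Ny≗diag yᵢ yⱼ Nv≡0 vᵢ) B″-basis
  in i , j , ij , d′ , (B″ , toKerBasis B″-kerBasis) , s≤s d′≤d
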